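{- A realizability predicate $\phi:|S|\to\mathcal P(\mathbb A)$ on an assembly $S$ is instance reducible to $\mathsf{LEM}$ (the realizability predicate on $\nabla(\mathcal P(\mathbb A))$) if and only if $\phi(x)\neq\emptyset$ for all $x\in|S|$.
   Context: A partial combinatory algebra (pca) is a set $\mathbb A$ with a partial binary operation $(a,b)\mapsto a\cdot b$ (associating to the left) such that there are $\mathsf K,\mathsf S\in\mathbb A$ with $\mathsf K\cdot a$ defined, $\mathsf K\cdot a\cdot b=a$, $\mathsf S\cdot a\cdot b$ defined and $\mathsf S\cdot a\cdot b\cdot c=(a\cdot c)\cdot(b\cdot c)$. An elementary sub-pca is a subset $\mathbb A'\subseteq\mathbb A$ closed under application and containing some such $\mathsf K,\mathsf S$. Every pca has $\mathtt{pair},\mathtt{fst},\mathtt{snd}$ with $\mathtt{fst}\cdot\langle a,b\rangle=a$, $\mathtt{snd}\cdot\langle a,b\rangle=b$ where $\langle a,b\rangle=\mathtt{pair}\cdot a\cdot b$, and numerals $\overline n$ for $n\in\mathbb N$. Fix a pca $\mathbb A$ and elementary sub-pca $\mathbb A'$. An assembly $S$ is a set $|S|$ with a relation $\Vdash_S\subseteq\mathbb A\times|S|$ such that every $x\in|S|$ has a realizer. A realizability predicate on $S$ is a map $\phi:|S|\to\mathcal P(\mathbb A)$. For a set $X$, $\nabla X$ is the assembly with $|\nabla X|=X$ and $r\Vdash x$ for all $r\in\mathbb A$, $x\in X$. $\mathsf{LEM}$ is the realizability predicate on $\nabla(\mathcal P(\mathbb A))$ given by $\mathsf{LEM}(\theta)=\{\langle\overline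 n,r\rangle\mid (n=1\wedge r\in\theta)\vee(n=0\wedge\theta=\emptyset)\}$. For realizability predicates $\phi$ on $S$ and $\psi$ on $T$, $\phi$ is instance reducible to $\psi$ when there exist $\ell_1,\ell_2\in\mathbb A'$ such that for all $s\in\mathbb A$, $x\in|S|$ with $s\Vdash_S x$ there is $y\in|T|$ with $\ell_1\cdot s$ defined and $\ell_1\cdot s\Vdash_T y$, and for all $p\in\psi(y)$, $\ell_2\cdot s\cdot p$ is defined and belongs to $\phi(x)$. -}

module Defs where

open import Level using (Level; _⊔_) renaming (suc to lsuc; zero to lzero)
open import Data.Nat using (ℕ)
open import Data.Product using (Σ; _×_; _,_)
open import Data.Sum using (_⊎_)
open import Relation.Nullary using (¬_)
open import Relation.Binary.PropositionalEquality using (_≡_)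

𝒫 : Set → Set₁
𝒫 A = A → Set

IsEmpty : {A : Set} → 𝒫 A → Set
IsEmpty θ = ∀ a → ¬ θ a

_⇔_ : ∀ {a b} → Set a → Set b → Set (a ⊔ b)
P ⇔ Q = (P → Q) × (Q → P)

-- Partial combinatory algebras.  The partial binary operation is given
-- as a functional relation  a · b ≃ c  meaning "a·b is defined and
-- equals c".

-- The K/S axioms for given elements K S of a partial applicative
-- structure (the equation for S is Kleene equality).
record IsKS {A : Set} (_·_≃_ : A → A → A → Set) (K S : A) : Set where
  field
    K-def  : ∀ a → Σ A λ k → K · a ≃ k
    K-beta : ∀ a b k → K · a ≃ k → k · b ≃ a
    S-def  : ∀ a b → Σ A λ s₁ → (S · a ≃ s₁) × (Σ A λ s₂ → s₁ · b ≃ s₂)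
    S-beta : ∀ a b c s₁ s₂ v → S · a ≃ s₁ → s₁ · b ≃ s₂ →
             (s₂ · c ≃ v) ⇔ (Σ A λ u → Σ A λ w → (a · c ≃ u) × (b · c ≃ w) × (u · w ≃ v))

record PCA : Set₁ where
  field
    Carrier    : Set
    _·_≃_      : Carrier → Carrier → Carrier → Set
    functional : ∀ {a b c c'} → a · b ≃ c → a · b ≃ c' → c ≡ c'
    K S        : Carrier
    isKS       : IsKS _·_≃_ K S

record SubPCA (𝔸 : PCA) : Set₁ where
  open PCA 𝔸
  field
    _∈A' : Carrier → Set
    closed : ∀ {a b c} → a ∈A' → b ∈A' → a · b ≃ c → c ∈A'
    K' S'  : Carrier
    K'∈A'  : K' ∈A'
    S'∈A'  : S' ∈A'
    isKS'  : IsKS _·_≃_ K' S'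

-- A choice of pairing combinators pair, fst, snd (taken in A', as the
-- standard ones built from the combinators of A' are) and numerals n̄.
record Pairing (𝔸 : PCA) (𝔸' : SubPCA 𝔸) : Set₁ where
  open PCA 𝔸
  open SubPCA 𝔸'
  field
    pair fst snd : Carrier
    pair∈A' : pair ∈A'
    fst∈A'  : fst ∈A'
    snd∈A'  : snd ∈A'
    num     : ℕ → Carrier
    num∈A'  : ∀ n → num n ∈A'
    pair₁   : Carrier → Carrier
    ⟨_,_⟩   : Carrier → Carrier → Carrier
    pair₁-spec : ∀ a → pair · a ≃ pair₁ a
    pair-spec  : ∀ a b → pair₁ a · b ≃ ⟨ a , b ⟩
    fst-spec   : ∀ a b → fst · ⟨ a , b ⟩ ≃ a
    snd-spec   : ∀ a b → snd · ⟨ a , b ⟩ ≃ b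

module _ (𝔸 : PCA) where
  open PCA 𝔸

  record Assembly (ℓ : Level) : Set (lsuc ℓ) where
    field
      ∣_∣       : Set ℓ
      _⊩_       : Carrier → ∣_∣ → Set
      realized  : ∀ x → Σ Carrier λ r → r ⊩ x
  open Assembly public

  RealPred : ∀ {ℓ} → Assembly ℓ → Set (lsuc lzero ⊔ ℓ)
  RealPred S = ∣ S ∣ → 𝒫 Carrier

  ∇ : ∀ {ℓ} → Set ℓ → Assembly ℓ
  ∇ X = record { ∣_∣ = X ; _⊩_ = λ _ _ → Carrier ; realized = λ x → K , K }

  InstanceReducible : ∀ {ℓ₁ ℓ₂} (𝔸' : SubPCA 𝔸) {S : Assembly ℓ₁} {T : Assembly ℓ₂} →
                      RealPred S → RealPred T → Set (ℓ₁ ⊔ ℓ₂)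
  InstanceReducible 𝔸' {S} {T} φ ψ =
    Σ Carrier λ ℓ₁ → Σ Carrier λ ℓ₂ → (ℓ₁ ∈A') × (ℓ₂ ∈A') ×
      (∀ (s : Carrier) (x : ∣ S ∣) → _⊩_ S s x →
        Σ ∣ T ∣ λ y →
          (Σ Carrier λ v → (ℓ₁ · s ≃ v) × _⊩_ T v y) ×
          (∀ p → ψ y p →
            Σ Carrier λ u → (ℓ₂ · s ≃ u) × (Σ Carrier λ w → (u · p ≃ w) × φ x w)))
    where open SubPCA 𝔸'

  LEM : (𝔸' : SubPCA 𝔸) → Pairing 𝔸 𝔸' → RealPred (∇ (𝒫 Carrier))
  LEM 𝔸' P θ a =
    Σ ℕ λ n → Σ Carrier λ r → (a ≡ ⟨ num n , r ⟩) ×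
      (((n ≡ 1) × θ r) ⊎ ((n ≡ 0) × IsEmpty θ))
    where open Pairing P

-- Over ∇(𝒫 𝔸) realizers carry no information, so a reduction of φ to LEM
-- amounts to a uniform way of decoding LEM-realizers into φ-realizers.
-- LEM θ cannot be empty: then θ is empty too (else some ⟨1̄, r⟩ realizes it),
-- and so ⟨0̄, K⟩ realizes LEM θ.
-- Hence a reduction forces φ x to be non-empty.  Conversely, if every φ x
-- is non-empty, the 0̄-branch of LEM (φ x) is absurd, so sending x to φ x
-- and decoding with snd (constantly in the realizer of x) is a reduction.
module Submission where

open import Defs
open import Level using (Level)
open import Relation.Nullary using (¬_)
open import Data.Product using (Σ; _×_; _,_; proj₁; proj₂)
open import Data.Sum using (inj₁; inj₂)
open import Data.Empty using (⊥-elim)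
open import Relation.Binary.PropositionalEquality using (refl)

module _ (𝔸 : PCA) (𝔸' : SubPCA 𝔸) where
  open PCA 𝔸 using (Carrier)

  reducible-preserves-nonempty : ∀ {ℓ₁ ℓ₂} {S : Assembly 𝔸 ℓ₁} {T : Assembly 𝔸 ℓ₂}
    {φ : RealPred 𝔸 S} {ψ : RealPred 𝔸 T} →
    InstanceReducible 𝔸 𝔸' {S = S} {T = T} φ ψ →
    (∀ y → ¬ IsEmpty (ψ y)) → ∀ x → ¬ IsEmpty (φ x)
  reducible-preserves-nonempty {S = S} (_ , _ , _ , _ , reduce) ψ-nonempty x φx-empty
    with realized S x
  ... | s , s⊩x with reduce s x s⊩x
  ... | y , _ , decode = ψ-nonempty y ψy-empty
    where
    ψy-empty : IsEmpty _
    ψy-empty p p∈ψy with decode p p∈ψy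
    ... | _ , _ , w , _ , w∈φx = φx-empty w w∈φx

  module _ (P : Pairing 𝔸 𝔸') where
    open PCA 𝔸 using (_·_≃_)
    open SubPCA 𝔸'
    open Pairing P
    open IsKS isKS'

    LEM-nonempty : (θ : 𝒫 Carrier) → ¬ IsEmpty (LEM 𝔸 𝔸' P θ)
    LEM-nonempty θ LEMθ-empty = LEMθ-empty ⟨ num 0 , K' ⟩ (0 , K' , refl , inj₂ (refl , θ-empty))
      where
      θ-empty : IsEmpty θ
      θ-empty r r∈θ = LEMθ-empty ⟨ num 1 , r ⟩ (1 , r , refl , inj₁ (refl , r∈θ))

    snd-decodes-LEM : {θ : 𝒫 Carrier} → ¬ IsEmpty θ →
      ∀ p → LEM 𝔸 𝔸' P θ p → Σ Carrier λ r → (snd · p ≃ r) × θ r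
    snd-decodes-LEM _ _ (_ , r , refl , inj₁ (refl , r∈θ)) = r , snd-spec (num 1) r , r∈θ
    snd-decodes-LEM θ-nonempty _ (_ , _ , refl , inj₂ (refl , θ-empty)) = ⊥-elim (θ-nonempty θ-empty)

    nonempty-reducible-to-LEM : ∀ {ℓ} {S : Assembly 𝔸 ℓ} {φ : RealPred 𝔸 S} →
      (∀ x → ¬ IsEmpty (φ x)) →
      InstanceReducible 𝔸 𝔸' {S = S} {T = ∇ 𝔸 (𝒫 Carrier)} φ (LEM 𝔸 𝔸' P)
    nonempty-reducible-to-LEM {φ = φ} φ-nonempty =
      K' , const-snd , K'∈A' , closed K'∈A' snd∈A' K'·snd≃const-snd ,
      λ s x _ → φ x , (proj₁ (K-def s) , proj₂ (K-def s) , K') ,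
        λ p p∈LEM → let r , snd·p≃r , r∈φx = snd-decodes-LEM (φ-nonempty x) p p∈LEM
                    in snd , K-beta snd s const-snd K'·snd≃const-snd , r , snd·p≃r , r∈φx
      where
      const-snd : Carrier
      const-snd = proj₁ (K-def snd)
      K'·snd≃const-snd : K' · snd ≃ const-snd
      K'·snd≃const-snd = proj₂ (K-def snd)

proposition3p6 : (𝔸 : PCA) (𝔸' : SubPCA 𝔸) (P : Pairing 𝔸 𝔸') {ℓ : Level}
    (S : Assembly 𝔸 ℓ) (φ : RealPred 𝔸 S) →
    InstanceReducible 𝔸 𝔸' {S = S} {T = ∇ 𝔸 (𝒫 (PCA.Carrier 𝔸))} φ (LEM 𝔸 𝔸' P)
    ⇔ (∀ (x : Assembly.∣ S ∣) → ¬ IsEmpty (φ x))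
proposition3p6 𝔸 𝔸' P S φ =
  (λ reduction → reducible-preserves-nonempty 𝔸 𝔸' {S = S} {T = ∇ 𝔸 (𝒫 (PCA.Carrier 𝔸))}
                   reduction (LEM-nonempty 𝔸 𝔸' P)) ,
  nonempty-reducible-to-LEM 𝔸 𝔸' P {S = S}
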